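{- Let $F=(F_1,F_2,\dots)$ be a GCD-morphic sequence of positive integers. Define recursively $c_1=F_1$ and, for $n\ge 2$, $$c_n=\frac{F_n}{\prod_{k\mid n,\,k<n}c_k}.$$ Then each $c_n$ is a positive integer and $F$ is the (pointwise) product $G_{c_1,1}\cdot G_{c_2,2}\cdot G_{c_3,3}\cdots$ of primary GCD-morphic sequences; that is, $F_m=\prod_{n\mid m}c_n$ for every $m\ge1$ (each entry of the product involves only finitely many factors different from $1$).
   Context: A sequence $(F_k)_{k\ge1}$ of positive integers is called GCD-morphic if $\gcd(F_k,F_l)=F_{\gcd(k,l)}$ for all $k,l\ge1$. For positive integers $c,N$, the primary GCD-morphic sequence $G_{c,N}=(g_k)_{k\ge1}$ is given by $g_k=c$ if $N\mid k$ and $g_k=1$ otherwise. Products of sequences are taken pointwise. -}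

module Defs where

open import Data.Nat using (ℕ; zero; suc; _+_; _*_; _∸_; _/_; _≟_; _≤_)
open import Data.Nat.Divisibility using (_∣_; _∣?_)
open import Data.Nat.GCD using (gcd)
open import Data.List using (List; map; filter; applyUpTo)
open import Data.Nat.ListAction using (product)
open import Relation.Binary.PropositionalEquality using (_≡_)
open import Relation.Nullary using (yes; no)

-- Sequences F_1, F_2, ... are modelled as functions ℕ → ℕ; the value at 0 is ignored.

GCDMorphic : (ℕ → ℕ) → Set
GCDMorphic F = ∀ k l → 1 ≤ k → 1 ≤ l → gcd (F k) (F l) ≡ F (gcd k l)

below : ℕ → List ℕ
below n = applyUpTo suc (n ∸ 1)

upToIncl : ℕ → List ℕ
upToIncl n = applyUpTo suc n

properDivProd : (ℕ → ℕ) → ℕ → ℕ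
properDivProd g n = product (map g (filter (λ k → k ∣? n) (below n)))

divProd : (ℕ → ℕ) → ℕ → ℕ
divProd g n = product (map g (filter (λ k → k ∣? n) (upToIncl n)))

-- natural-number quotient (floor division), with a / 0 := 0
quot : ℕ → ℕ → ℕ
quot a zero = 0
quot a (suc b) = a / suc b

cStep : (ℕ → ℕ) → (ℕ → ℕ) → ℕ → ℕ
cStep F g m = quot (F m) (properDivProd g m)

-- cTable F n k = c_k for 1 ≤ k ≤ n (and 0 otherwise)
cTable : (ℕ → ℕ) → ℕ → ℕ → ℕ
cTable F zero k = 0
cTable F (suc n) k with k ≟ suc n
... | yes _ = cStep F (cTable F n) (suc n)
... | no _ = cTable F n k

-- the sequence c_n from the paper (c_1 = F_1 since the empty product is 1)
c : (ℕ → ℕ) → ℕ → ℕ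
c F n = cTable F n n

module Submission where

-- Equivalently c n * ∏_{k ∣ n, k < n} c k = F n,
-- which we prove by strong induction on n.  The only non-trivial point is that the
-- division is exact, i.e. that P n = ∏_{k ∣ n, k < n} c k divides F n.
--
-- For this we show P n = lcm { F d : d a proper divisor of n }; each F d divides F n
-- (as gcd (F d) (F n) = F (gcd d n) = F d), hence so does their lcm.  The lcm identity
-- is an inclusion–exclusion argument: by the induction hypothesis F d = ∏_{e ∣ d} c e
-- for every proper divisor d, and for a list S of such divisors
--   ∏_{e ∣ some s ∈ S} c e = lcm_{s ∈ S} F s,
-- proved by induction on S from  ∏_{A ∪ B} · ∏_{A ∩ B} = ∏_A · ∏_B,  the identity
-- {e ∣ d} ∩ {e ∣ some s ∈ S} = {e ∣ some gcd d s, s ∈ S},  gcd-morphy, and the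
-- distributivity of gcd over lcm.

open import Defs
open import Data.Nat using (ℕ; zero; suc; _*_; _∸_; _≤_; _<_; s≤s; z≤n; _≟_; >-nonZero)
open import Data.Nat.Properties
  using (*-comm; *-assoc; *-identityˡ; *-identityʳ; *-cancelʳ-≡; *-commutativeSemigroup;
         ≤-refl; ≤-trans; ≤-pred; ≤-<-trans; ≤∧≢⇒<; <⇒≱; ∸-monoˡ-≤; n≢0⇒n>0)
open import Data.Nat.Divisibility
  using (_∣_; _∣?_; 1∣_; ∣-refl; ∣-trans; ∣-antisym; ∣⇒≤; *-pres-∣; *-cancelˡ-∣; 0∣⇒≡0)
open import Data.Nat.DivMod using (m/n*n≡m)
open import Data.Nat.GCD
  using (gcd; gcd[m,n]∣m; gcd[m,n]∣n; gcd-greatest; gcd-identityˡ; gcd-zeroʳ;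
         gcd[m,n]≢0; c*gcd[m,n]≡gcd[cm,cn])
open import Data.Nat.LCM using (lcm; lcm-least; m∣lcm[m,n]; n∣lcm[m,n]; gcd*lcm)
open import Data.Nat.Induction using (<-rec)
open import Data.Nat.ListAction using (product)
open import Data.Bool using (Bool; true; false; _∧_; _∨_; if_then_else_)
open import Data.Bool.Properties using (∧-distribˡ-∨; ∧-zeroʳ; ∨-zeroʳ; ¬-not)
open import Data.List using (List; []; _∷_; _++_; _∷ʳ_; map; filter; applyUpTo; length)
open import Data.List.Properties using (applyUpTo-∷ʳ; length-map)
open import Data.List.Membership.Propositional using (_∈_)
open import Data.List.Membership.Propositional.Properties using (∈-applyUpTo⁻; ∈-filter⁺; ∈-filter⁻)
open import Data.List.Relation.Unary.Any using (here; there)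
open import Data.List.Relation.Unary.All as All using (All; []; _∷_)
open import Data.List.Relation.Unary.All.Properties using (map⁺)
open import Data.Product using (_×_; _,_; proj₁; proj₂)
open import Data.Sum using (inj₁)
open import Data.Empty using (⊥-elim)
open import Function using (_∘_)
open import Relation.Binary.PropositionalEquality
open import Relation.Nullary using (yes; no; does)
open import Relation.Nullary.Decidable using (dec-true; dec-false)
open import Relation.Unary using (Pred; Decidable)
open import Algebra.Properties.CommutativeSemigroup *-commutativeSemigroup
  using (interchange; x∙yz≈y∙xz)

open ≡-Reasoning

gcd-pos : ∀ a b → 1 ≤ a → 1 ≤ gcd a b
gcd-pos (suc a) b _ = n≢0⇒n>0 (gcd[m,n]≢0 (suc a) b (inj₁ (λ ())))

gcd-distribˡ-gcd : ∀ a x y → gcd a (gcd x y) ≡ gcd (gcd a x) (gcd a y)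
gcd-distribˡ-gcd a x y = ∣-antisym
  (gcd-greatest (gcd-greatest ∣a (∣-trans ∣xy (gcd[m,n]∣m x y)))
                (gcd-greatest ∣a (∣-trans ∣xy (gcd[m,n]∣n x y))))
  (gcd-greatest (∣-trans (gcd[m,n]∣m (gcd a x) (gcd a y)) (gcd[m,n]∣m a x))
                (gcd-greatest (∣-trans (gcd[m,n]∣m (gcd a x) (gcd a y)) (gcd[m,n]∣n a x))
                              (∣-trans (gcd[m,n]∣n (gcd a x) (gcd a y)) (gcd[m,n]∣n a y))))
  where
  ∣a : gcd a (gcd x y) ∣ a
  ∣a = gcd[m,n]∣m a (gcd x y)
  ∣xy : gcd a (gcd x y) ∣ gcd x y
  ∣xy = gcd[m,n]∣n a (gcd x y)

∣-gcd*gcd : ∀ {d} a x b y → d ∣ a * b → d ∣ x * b → d ∣ a * y → d ∣ x * y →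
            d ∣ gcd a x * gcd b y
∣-gcd*gcd {d} a x b y d∣ab d∣xb d∣ay d∣xy =
  subst (d ∣_) (sym expand) (gcd-greatest (gcd-greatest d∣ab d∣xb) (gcd-greatest d∣ay d∣xy))
  where
  gcd*ʳ : ∀ m n o → gcd m n * o ≡ gcd (m * o) (n * o)
  gcd*ʳ m n o = trans (*-comm (gcd m n) o)
    (trans (c*gcd[m,n]≡gcd[cm,cn] o m n) (cong₂ gcd (*-comm o m) (*-comm o n)))
  expand : gcd a x * gcd b y ≡ gcd (gcd (a * b) (x * b)) (gcd (a * y) (x * y))
  expand = begin
    gcd a x * gcd b y                   ≡⟨ c*gcd[m,n]≡gcd[cm,cn] (gcd a x) b y ⟩
    gcd (gcd a x * b) (gcd a x * y)     ≡⟨ cong₂ gcd (gcd*ʳ a x b) (gcd*ʳ a x y) ⟩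
    gcd (gcd (a * b) (x * b)) (gcd (a * y) (x * y)) ∎

-- For a > 0, with t = gcd a (gcd x y) = gcd u v one has
-- h * t ∣ u * v = t * lcm u v, where h is the left-hand side; cancelling t gives
-- h ∣ lcm u v, and the converse divisibility is immediate.
gcd-distribˡ-lcm : ∀ a x y → gcd a (lcm x y) ≡ lcm (gcd a x) (gcd a y)
gcd-distribˡ-lcm zero x y
  rewrite gcd-identityˡ (lcm x y) | gcd-identityˡ x | gcd-identityˡ y = refl
gcd-distribˡ-lcm a@(suc _) x y = ∣-antisym h∣lcm[u,v] lcm[u,v]∣h
  where
  h u v t : ℕ
  h = gcd a (lcm x y)
  u = gcd a x
  v = gcd a y
  t = gcd a (gcd x y)
  h∣a : h ∣ a
  h∣a = gcd[m,n]∣m a (lcm x y)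
  t∣a : t ∣ a
  t∣a = gcd[m,n]∣m a (gcd x y)
  t∣x : t ∣ x
  t∣x = ∣-trans (gcd[m,n]∣n a (gcd x y)) (gcd[m,n]∣m x y)
  t∣y : t ∣ y
  t∣y = ∣-trans (gcd[m,n]∣n a (gcd x y)) (gcd[m,n]∣n x y)
  ht∣xy : h * t ∣ x * y
  ht∣xy = subst (h * t ∣_) (trans (*-comm (lcm x y) (gcd x y)) (gcd*lcm x y))
    (*-pres-∣ (gcd[m,n]∣n a (lcm x y)) (gcd[m,n]∣n a (gcd x y)))
  ht∣uv : h * t ∣ u * v
  ht∣uv = ∣-gcd*gcd a x a y (*-pres-∣ h∣a t∣a)
    (subst (h * t ∣_) (*-comm a x) (*-pres-∣ h∣a t∣x)) (*-pres-∣ h∣a t∣y) ht∣xy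
  uv≡t*lcm : u * v ≡ t * lcm u v
  uv≡t*lcm = trans (sym (gcd*lcm u v)) (cong (_* lcm u v) (sym (gcd-distribˡ-gcd a x y)))
  h∣lcm[u,v] : h ∣ lcm u v
  h∣lcm[u,v] = *-cancelˡ-∣ t {{>-nonZero (gcd-pos a (gcd x y) (s≤s z≤n))}}
    (subst₂ _∣_ (*-comm h t) uv≡t*lcm ht∣uv)
  lcm[u,v]∣h : lcm u v ∣ h
  lcm[u,v]∣h = lcm-least
    (gcd-greatest (gcd[m,n]∣m a x) (∣-trans (gcd[m,n]∣n a x) (m∣lcm[m,n] x y)))
    (gcd-greatest (gcd[m,n]∣m a y) (∣-trans (gcd[m,n]∣n a y) (n∣lcm[m,n] x y)))

lcms : List ℕ → ℕ
lcms [] = 1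
lcms (x ∷ xs) = lcm x (lcms xs)

lcms-least : ∀ {m} xs → All (_∣ m) xs → lcms xs ∣ m
lcms-least {m} [] [] = 1∣ m
lcms-least (x ∷ xs) (x∣m ∷ xs∣m) = lcm-least x∣m (lcms-least xs xs∣m)

gcd-distribˡ-lcms : ∀ a xs → gcd a (lcms xs) ≡ lcms (map (gcd a) xs)
gcd-distribˡ-lcms a [] = gcd-zeroʳ a
gcd-distribˡ-lcms a (x ∷ xs) =
  trans (gcd-distribˡ-lcm a x (lcms xs)) (cong (lcm (gcd a x)) (gcd-distribˡ-lcms a xs))

prodWhere : (ℕ → ℕ) → (ℕ → Bool) → List ℕ → ℕ
prodWhere g p [] = 1
prodWhere g p (x ∷ xs) = if p x then g x * prodWhere g p xs else prodWhere g p xs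

product-filter : ∀ {ℓ} g {P : Pred ℕ ℓ} (P? : Decidable P) xs →
                 product (map g (filter P? xs)) ≡ prodWhere g (does ∘ P?) xs
product-filter g P? [] = refl
product-filter g P? (x ∷ xs) with does (P? x)
... | true = cong (g x *_) (product-filter g P? xs)
... | false = product-filter g P? xs

prodWhere-++ : ∀ g p xs ys → prodWhere g p (xs ++ ys) ≡ prodWhere g p xs * prodWhere g p ys
prodWhere-++ g p [] ys = sym (*-identityˡ _)
prodWhere-++ g p (x ∷ xs) ys with p x
... | true = trans (cong (g x *_) (prodWhere-++ g p xs ys)) (sym (*-assoc (g x) _ _))
... | false = prodWhere-++ g p xs ys

prodWhere-∷ʳ-true : ∀ g p xs x → p x ≡ true → prodWhere g p (xs ∷ʳ x) ≡ prodWhere g p xs * g x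
prodWhere-∷ʳ-true g p xs x px rewrite prodWhere-++ g p xs (x ∷ []) | px | *-identityʳ (g x) = refl

prodWhere-∷ʳ-false : ∀ g p xs x → p x ≡ false → prodWhere g p (xs ∷ʳ x) ≡ prodWhere g p xs
prodWhere-∷ʳ-false g p xs x px rewrite prodWhere-++ g p xs (x ∷ []) | px = *-identityʳ _

prodWhere-cong : ∀ {g h p q} xs →
                 (∀ {x} → x ∈ xs → g x ≡ h x) → (∀ {x} → x ∈ xs → p x ≡ q x) →
                 prodWhere g p xs ≡ prodWhere h q xs
prodWhere-cong [] _ _ = refl
prodWhere-cong {g} {h} {p} {q} (x ∷ xs) g≡h p≡q
  rewrite p≡q (here refl) | g≡h (here refl) | prodWhere-cong xs (g≡h ∘ there) (p≡q ∘ there) = refl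

prodWhere-none : ∀ g xs → prodWhere g (λ _ → false) xs ≡ 1
prodWhere-none g [] = refl
prodWhere-none g (x ∷ xs) = prodWhere-none g xs

prodWhere-∨-∧ : ∀ g p q xs →
  prodWhere g (λ x → p x ∨ q x) xs * prodWhere g (λ x → p x ∧ q x) xs ≡
  prodWhere g p xs * prodWhere g q xs
prodWhere-∨-∧ g p q [] = refl
prodWhere-∨-∧ g p q (x ∷ xs) with p x | q x | prodWhere-∨-∧ g p q xs
... | true  | true  | ih = begin
  (g x * A) * (g x * B)   ≡⟨ interchange (g x) A (g x) B ⟩
  (g x * g x) * (A * B)   ≡⟨ cong (g x * g x *_) ih ⟩
  (g x * g x) * (C * D)   ≡⟨ interchange (g x) (g x) C D ⟩
  (g x * C) * (g x * D)   ∎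
  where
  A B C D : ℕ
  A = prodWhere g (λ x → p x ∨ q x) xs
  B = prodWhere g (λ x → p x ∧ q x) xs
  C = prodWhere g p xs
  D = prodWhere g q xs
... | true  | false | ih = trans (*-assoc (g x) _ _) (trans (cong (g x *_) ih) (sym (*-assoc (g x) _ _)))
... | false | true  | ih = trans (*-assoc (g x) _ _)
  (trans (cong (g x *_) ih) (sym (x∙yz≈y∙xz (prodWhere g p xs) (g x) (prodWhere g q xs))))
... | false | false | ih = ih

_∣ᵇ_ : ℕ → ℕ → Bool
e ∣ᵇ s = does (e ∣? s)

divisorOfSome : List ℕ → ℕ → Bool
divisorOfSome [] e = false
divisorOfSome (s ∷ S) e = e ∣ᵇ s ∨ divisorOfSome S e

∣ᵇ-gcd : ∀ e d s → (e ∣ᵇ d ∧ e ∣ᵇ s) ≡ e ∣ᵇ gcd d s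
∣ᵇ-gcd e d s with e ∣? d | e ∣? s
... | yes e∣d | yes e∣s = sym (dec-true (e ∣? gcd d s) (gcd-greatest e∣d e∣s))
... | yes _   | no e∤s  = sym (dec-false (e ∣? gcd d s) (e∤s ∘ (λ e∣g → ∣-trans e∣g (gcd[m,n]∣n d s))))
... | no e∤d  | _       = sym (dec-false (e ∣? gcd d s) (e∤d ∘ (λ e∣g → ∣-trans e∣g (gcd[m,n]∣m d s))))

∧-divisorOfSome : ∀ e d S → (e ∣ᵇ d ∧ divisorOfSome S e) ≡ divisorOfSome (map (gcd d) S) e
∧-divisorOfSome e d [] = ∧-zeroʳ (e ∣ᵇ d)
∧-divisorOfSome e d (s ∷ S) = trans (∧-distribˡ-∨ (e ∣ᵇ d) (e ∣ᵇ s) (divisorOfSome S e))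
  (cong₂ _∨_ (∣ᵇ-gcd e d s) (∧-divisorOfSome e d S))

divisorOfSome-complete : ∀ {e s} S → s ∈ S → e ∣ s → divisorOfSome S e ≡ true
divisorOfSome-complete {e} (s ∷ S) (here refl) e∣s rewrite dec-true (e ∣? s) e∣s = refl
divisorOfSome-complete {e} (s ∷ S) (there s∈S) e∣s =
  trans (cong (e ∣ᵇ s ∨_) (divisorOfSome-complete S s∈S e∣s)) (∨-zeroʳ (e ∣ᵇ s))

divisorOfSome-sound : ∀ {e m} S → All (_∣ m) S → divisorOfSome S e ≡ true → e ∣ m
divisorOfSome-sound {e} (s ∷ S) (s∣m ∷ S∣m) e∣S with e ∣? s
... | yes e∣s = ∣-trans e∣s s∣m
... | no _ = divisorOfSome-sound S S∣m e∣S

∈-below⁻ : ∀ n {e} → e ∈ below n → 1 ≤ e × e < n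
∈-below⁻ (suc n) e∈ with i , i<n , refl ← ∈-applyUpTo⁻ suc e∈ = s≤s z≤n , s≤s i<n

divProd-split : ∀ g d → 1 ≤ d → divProd g d ≡ properDivProd g d * g d
divProd-split g (suc d) _ = begin
  divProd g (suc d)
    ≡⟨ product-filter g (_∣? suc d) (applyUpTo suc (suc d)) ⟩
  prodWhere g (_∣ᵇ suc d) (applyUpTo suc (suc d))
    ≡⟨ cong (prodWhere g (_∣ᵇ suc d)) (sym (applyUpTo-∷ʳ suc d)) ⟩
  prodWhere g (_∣ᵇ suc d) (applyUpTo suc d ∷ʳ suc d)
    ≡⟨ prodWhere-∷ʳ-true g (_∣ᵇ suc d) (applyUpTo suc d) (suc d) (dec-true (suc d ∣? suc d) ∣-refl) ⟩
  prodWhere g (_∣ᵇ suc d) (applyUpTo suc d) * g (suc d)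
    ≡⟨ cong (_* g (suc d)) (sym (product-filter g (_∣? suc d) (applyUpTo suc d))) ⟩
  properDivProd g (suc d) * g (suc d) ∎

-- The divisor product of d may be taken over any range [1, ..., m] with d ≤ m,
-- since the extra indices exceed d and so do not divide it.
divProd-extend : ∀ g {d} m → 1 ≤ d → d ≤ m → prodWhere g (_∣ᵇ d) (applyUpTo suc m) ≡ divProd g d
divProd-extend g zero 1≤d d≤0 with () ← ≤-trans 1≤d d≤0
divProd-extend g {d} (suc m) 1≤d d≤1+m with d ≟ suc m
... | yes refl = sym (product-filter g (_∣? d) (applyUpTo suc d))
... | no d≢1+m = begin
  prodWhere g (_∣ᵇ d) (applyUpTo suc (suc m))
    ≡⟨ cong (prodWhere g (_∣ᵇ d)) (sym (applyUpTo-∷ʳ suc m)) ⟩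
  prodWhere g (_∣ᵇ d) (applyUpTo suc m ∷ʳ suc m)
    ≡⟨ prodWhere-∷ʳ-false g (_∣ᵇ d) (applyUpTo suc m) (suc m) top-not-divisor ⟩
  prodWhere g (_∣ᵇ d) (applyUpTo suc m)
    ≡⟨ divProd-extend g m 1≤d (≤-pred d<1+m) ⟩
  divProd g d ∎
  where
  d<1+m : d < suc m
  d<1+m = ≤∧≢⇒< d≤1+m d≢1+m
  top-not-divisor : suc m ∣ᵇ d ≡ false
  top-not-divisor = dec-false (suc m ∣? d) (λ 1+m∣d → <⇒≱ d<1+m (∣⇒≤ {{>-nonZero 1≤d}} 1+m∣d))

properDivProd-cong : ∀ {g h} n → (∀ {k} → 1 ≤ k → k < n → g k ≡ h k) →
                     properDivProd g n ≡ properDivProd h n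
properDivProd-cong {g} {h} n g≡h = begin
  properDivProd g n                     ≡⟨ product-filter g (_∣? n) (below n) ⟩
  prodWhere g (_∣ᵇ n) (below n)         ≡⟨ prodWhere-cong (below n) agree (λ _ → refl) ⟩
  prodWhere h (_∣ᵇ n) (below n)         ≡⟨ sym (product-filter h (_∣? n) (below n)) ⟩
  properDivProd h n                     ∎
  where
  agree : ∀ {k} → k ∈ below n → g k ≡ h k
  agree k∈ = let 1≤k , k<n = ∈-below⁻ n k∈ in g≡h 1≤k k<n

-- Inclusion–exclusion for unions of divisor sets

module UnionOfDivisorSets
  (g F : ℕ → ℕ) (xs : List ℕ) (Good : ℕ → Set)
  (good-gcd : ∀ {d s} → Good d → Good s → Good (gcd d s))
  (F-pos : ∀ {d} → Good d → 1 ≤ F d)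
  (F-morphic : ∀ {d s} → Good d → Good s → gcd (F d) (F s) ≡ F (gcd d s))
  (F-divisors : ∀ {d} → Good d → prodWhere g (_∣ᵇ d) xs ≡ F d)
  where

  F-map-gcd : ∀ {d} S → Good d → All Good S → map F (map (gcd d) S) ≡ map (gcd (F d)) (map F S)
  F-map-gcd [] _ _ = refl
  F-map-gcd (s ∷ S) good-d (good-s ∷ good-S) =
    cong₂ _∷_ (sym (F-morphic good-d good-s)) (F-map-gcd S good-d good-S)

  -- The induction is on the length bound k, since the overlap term replaces S by
  -- the list map (gcd d) S of the same length.
  union : ∀ k S → length S ≤ k → All Good S → prodWhere g (divisorOfSome S) xs ≡ lcms (map F S)
  union k [] _ _ = prodWhere-none g xs
  union (suc k) (d ∷ S) (s≤s |S|≤k) (good-d ∷ good-S) =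
    *-cancelʳ-≡ U (lcm (F d) L) G {{>-nonZero (gcd-pos (F d) L (F-pos good-d))}} U*G≡lcm*G
    where
    U L G : ℕ
    U = prodWhere g (divisorOfSome (d ∷ S)) xs
    L = lcms (map F S)
    G = gcd (F d) L
    -- The overlap {e ∣ d} ∩ {e ∣ some s ∈ S} has product G, by induction on map (gcd d) S.
    overlap-product : prodWhere g (λ e → e ∣ᵇ d ∧ divisorOfSome S e) xs ≡ G
    overlap-product = begin
      prodWhere g (λ e → e ∣ᵇ d ∧ divisorOfSome S e) xs
        ≡⟨ prodWhere-cong xs (λ _ → refl) (λ {e} _ → ∧-divisorOfSome e d S) ⟩
      prodWhere g (divisorOfSome (map (gcd d) S)) xs
        ≡⟨ union k (map (gcd d) S) (subst (_≤ k) (sym (length-map (gcd d) S)) |S|≤k)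
                 (map⁺ (All.map (good-gcd good-d) good-S)) ⟩
      lcms (map F (map (gcd d) S))
        ≡⟨ cong lcms (F-map-gcd S good-d good-S) ⟩
      lcms (map (gcd (F d)) (map F S))
        ≡⟨ sym (gcd-distribˡ-lcms (F d) (map F S)) ⟩
      G ∎
    U*G≡lcm*G : U * G ≡ lcm (F d) L * G
    U*G≡lcm*G = begin
      U * G
        ≡⟨ cong (U *_) (sym overlap-product) ⟩
      U * prodWhere g (λ e → e ∣ᵇ d ∧ divisorOfSome S e) xs
        ≡⟨ prodWhere-∨-∧ g (_∣ᵇ d) (divisorOfSome S) xs ⟩
      prodWhere g (_∣ᵇ d) xs * prodWhere g (divisorOfSome S) xs
        ≡⟨ cong₂ _*_ (F-divisors good-d) (union k S |S|≤k good-S) ⟩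
      F d * L
        ≡⟨ sym (gcd*lcm (F d) L) ⟩
      G * lcm (F d) L
        ≡⟨ *-comm G (lcm (F d) L) ⟩
      lcm (F d) L * G ∎

quot*divisor : ∀ {a b} → b ∣ a → 1 ≤ a → quot a b * b ≡ a
quot*divisor {b = zero} 0∣a 1≤a with () ← subst (1 ≤_) (0∣⇒≡0 0∣a) 1≤a
quot*divisor {b = suc b} b∣a _ = m/n*n≡m b∣a

factor-pos : ∀ {x y z} → x * y ≡ z → 1 ≤ z → 1 ≤ x
factor-pos {zero} refl ()
factor-pos {suc x} _ _ = s≤s z≤n

module _ (F : ℕ → ℕ) where

  c-suc : ∀ n → c F (suc n) ≡ cStep F (cTable F n) (suc n)
  c-suc n with suc n ≟ suc n
  ... | yes _ = refl
  ... | no 1+n≢1+n = ⊥-elim (1+n≢1+n refl)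

  cTable-stable : ∀ n k → k ≤ n → cTable F n k ≡ c F k
  cTable-stable zero .zero z≤n = refl
  cTable-stable (suc n) k k≤1+n with k ≟ suc n
  ... | yes refl = sym (c-suc n)
  ... | no k≢1+n = cTable-stable n k (≤-pred (≤∧≢⇒< k≤1+n k≢1+n))

  c-unfold : ∀ n → 1 ≤ n → c F n ≡ quot (F n) (properDivProd (c F) n)
  c-unfold (suc n) _ = trans (c-suc n)
    (cong (quot (F (suc n))) (properDivProd-cong (suc n) (λ _ k<1+n → cTable-stable n _ (≤-pred k<1+n))))

module Factorisation (F : ℕ → ℕ) (F-pos : ∀ k → 1 ≤ k → 1 ≤ F k) (morphic : GCDMorphic F) where

  Factored : ℕ → Set
  Factored n = 1 ≤ n → c F n * properDivProd (c F) n ≡ F n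

  -- Divisibility of indices is inherited by the values: F d = gcd (F d) (F n) when d ∣ n.
  F-mono-∣ : ∀ {d n} → 1 ≤ d → 1 ≤ n → d ∣ n → F d ∣ F n
  F-mono-∣ {d} {n} 1≤d 1≤n d∣n = subst (_∣ F n) gcd≡F[d] (gcd[m,n]∣n (F d) (F n))
    where
    gcd≡F[d] : gcd (F d) (F n) ≡ F d
    gcd≡F[d] = trans (morphic d n 1≤d 1≤n)
      (cong F (∣-antisym (gcd[m,n]∣m d n) (gcd-greatest ∣-refl d∣n)))

  module ProperDivisors (n : ℕ) (1≤n : 1 ≤ n) (IH : ∀ {d} → d < n → Factored d) where

    ProperDivisor : ℕ → Set
    ProperDivisor d = 1 ≤ d × d ∣ n × d < n

    properDivisors : List ℕ
    properDivisors = filter (_∣? n) (below n)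

    all-proper : All ProperDivisor properDivisors
    all-proper = All.tabulate proper
      where
      proper : ∀ {d} → d ∈ properDivisors → ProperDivisor d
      proper d∈ with d∈below , d∣n ← ∈-filter⁻ (_∣? n) d∈
                with 1≤d , d<n ← ∈-below⁻ n d∈below = 1≤d , d∣n , d<n

    gcd-proper : ∀ {d s} → ProperDivisor d → ProperDivisor s → ProperDivisor (gcd d s)
    gcd-proper {d} {s} (1≤d , d∣n , d<n) _ =
      gcd-pos d s 1≤d , ∣-trans (gcd[m,n]∣m d s) d∣n ,
      ≤-<-trans (∣⇒≤ {{>-nonZero 1≤d}} (gcd[m,n]∣m d s)) d<n

    F-divisors : ∀ {d} → ProperDivisor d → prodWhere (c F) (_∣ᵇ d) (below n) ≡ F d
    F-divisors {d} (1≤d , _ , d<n) = begin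
      prodWhere (c F) (_∣ᵇ d) (below n)   ≡⟨ divProd-extend (c F) (n ∸ 1) 1≤d (∸-monoˡ-≤ 1 d<n) ⟩
      divProd (c F) d                     ≡⟨ divProd-split (c F) d 1≤d ⟩
      properDivProd (c F) d * c F d       ≡⟨ *-comm (properDivProd (c F) d) (c F d) ⟩
      c F d * properDivProd (c F) d       ≡⟨ IH d<n 1≤d ⟩
      F d                                 ∎

    open UnionOfDivisorSets (c F) F (below n) ProperDivisor gcd-proper
      (λ (1≤d , _) → F-pos _ 1≤d) (λ (1≤d , _) (1≤s , _) → morphic _ _ 1≤d 1≤s) F-divisors

    divisor-of-n : ∀ {e} → e ∈ below n → e ∣ᵇ n ≡ divisorOfSome properDivisors e
    divisor-of-n {e} e∈ with e ∣? n
    ... | yes e∣n = sym (divisorOfSome-complete properDivisors (∈-filter⁺ (_∣? n) e∈ e∣n) ∣-refl)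
    ... | no e∤n = sym (¬-not (e∤n ∘ divisorOfSome-sound properDivisors divide-n))
      where
      divide-n : All (_∣ n) properDivisors
      divide-n = All.map (proj₁ ∘ proj₂) all-proper

    properDivProd-lcm : properDivProd (c F) n ≡ lcms (map F properDivisors)
    properDivProd-lcm = begin
      properDivProd (c F) n
        ≡⟨ product-filter (c F) (_∣? n) (below n) ⟩
      prodWhere (c F) (_∣ᵇ n) (below n)
        ≡⟨ prodWhere-cong (below n) (λ _ → refl) divisor-of-n ⟩
      prodWhere (c F) (divisorOfSome properDivisors) (below n)
        ≡⟨ union (length properDivisors) properDivisors ≤-refl all-proper ⟩
      lcms (map F properDivisors) ∎

    -- Each F d divides F n, hence so does their lcm.
    properDivProd-∣ : properDivProd (c F) n ∣ F n
    properDivProd-∣ = subst (_∣ F n) (sym properDivProd-lcm)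
      (lcms-least (map F properDivisors)
        (map⁺ (All.map (λ (1≤d , d∣n , _) → F-mono-∣ 1≤d 1≤n d∣n) all-proper)))

  -- c n * ∏_{k ∣ n, k < n} c k = F n, since the division defining c n is exact.
  factored : ∀ n → Factored n
  factored = <-rec Factored step
    where
    step : ∀ n → (∀ {d} → d < n → Factored d) → Factored n
    step n IH 1≤n = begin
      c F n * properDivProd (c F) n
        ≡⟨ cong (_* properDivProd (c F) n) (c-unfold F n 1≤n) ⟩
      quot (F n) (properDivProd (c F) n) * properDivProd (c F) n
        ≡⟨ quot*divisor (ProperDivisors.properDivProd-∣ n 1≤n IH) (F-pos n 1≤n) ⟩
      F n ∎

  c-pos : ∀ n → 1 ≤ n → 1 ≤ c F n
  c-pos n 1≤n = factor-pos (factored n 1≤n) (F-pos n 1≤n)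

  F-divProd : ∀ m → 1 ≤ m → F m ≡ divProd (c F) m
  F-divProd m 1≤m = sym (begin
    divProd (c F) m                   ≡⟨ divProd-split (c F) m 1≤m ⟩
    properDivProd (c F) m * c F m     ≡⟨ *-comm (properDivProd (c F) m) (c F m) ⟩
    c F m * properDivProd (c F) m     ≡⟨ factored m 1≤m ⟩
    F m                               ∎)

mainTheorem2 : (F : ℕ → ℕ)
    → (∀ k → 1 ≤ k → 1 ≤ F k)
    → GCDMorphic F
    → (∀ n → 1 ≤ n → (1 ≤ c F n) × (c F n * properDivProd (c F) n ≡ F n))
      × (∀ m → 1 ≤ m → F m ≡ divProd (c F) m)
mainTheorem2 F F-pos morphic = (λ n 1≤n → c-pos n 1≤n , factored n 1≤n) , F-divProd
  where open Factorisation F F-pos morphic
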